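{- Let $R$ be a commutative ring, $n,m\ge1$, $f_1,\dots,f_k,g_1,\dots,g_h\in A_R(m)$, and $\alpha\in\mathbb{N}^k$, $\beta\in\mathbb{N}^h$ with $\sum_i\alpha_i\le n$ and $\sum_j\beta_j\le n$. Then $$e_\alpha(f_1,\dots,f_k)\,e_\beta(g_1,\dots,g_h)=\sum_\gamma e_\gamma(f_1,\dots,f_k,g_1,\dots,g_h,f_1g_1,f_1g_2,\dots,f_1g_h,f_2g_1,\dots,f_kg_h),$$ where the sum runs over all tuples $\gamma=(\gamma_{10},\dots,\gamma_{k0},\gamma_{01},\dots,\gamma_{0h},\gamma_{11},\gamma_{12},\dots,\gamma_{kh})$ of nonnegative integers (the entry $\gamma_{i0}$ attached to $f_i$, $\gamma_{0j}$ to $g_j$, and $\gamma_{ij}$ to $f_ig_j$ for $i,j\ge1$) such that $\sum\gamma\le n$ (sum of all entries), $\sum_{j=0}^h\gamma_{ij}=\alpha_i$ for $i=1,\dots,k$, and $\sum_{i=0}^k\gamma_{ij}=\beta_j$ for $j=1,\dots,h$.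
   Context: $A_R(n,m)=R[x_i(j):1\le i\le m,1\le j\le n]$; $A_R(m)=R[y_1,\dots,y_m]$; for $f\in A_R(m)$, $f(j):=f(x_1(j),\dots,x_m(j))$. For $f_1,\dots,f_r\in A_R(m)$ and $\delta\in\mathbb{N}^r$ with $\sum\delta_i\le n$, $e_\delta(f_1,\dots,f_r)\in A_R(n,m)$ is the coefficient of $t_1^{\delta_1}\cdots t_r^{\delta_r}$ in $\prod_{i=1}^n\bigl(1+\sum_{l=1}^r t_lf_l(i)\bigr)$ ($t_l$ commuting indeterminates). -}

module Defs where

open import Level using (_⊔_)
open import Algebra.Bundles using (CommutativeRing)
open import Data.Bool using (Bool; true; false; if_then_else_; _∧_)
open import Data.Nat using (ℕ; zero; suc; _+_; _*_; _∸_; _≡ᵇ_; _≤ᵇ_)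
open import Data.Fin using (Fin)
open import Data.Product using (_×_; _,_)
open import Data.List as L using (List; upTo; concatMap; filterᵇ)
open import Data.Vec as V using (Vec; []; _∷_)

-- A polynomial in t is represented by its
-- coefficient function  Vec ℕ r → A  (exponent vector ↦ coefficient).

below : ∀ {r} → Vec ℕ r → List (Vec ℕ r)
below []      = [] L.∷ L.[]
below (d ∷ δ) = concatMap (λ i → L.map (i ∷_) (below δ)) (upTo (suc d))

allVec : ∀ {a} {A : Set a} (r : ℕ) → List A → List (Vec A r)
allVec zero    xs = [] L.∷ L.[]
allVec (suc r) xs = concatMap (λ x → L.map (x ∷_) (allVec r xs)) xs

eqVᵇ : ∀ {r} → Vec ℕ r → Vec ℕ r → Bool
eqVᵇ []      []      = true
eqVᵇ (a ∷ u) (b ∷ v) = (a ≡ᵇ b) ∧ eqVᵇ u v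

unitV : ∀ {r} → Fin r → Vec ℕ r
unitV l = V.updateAt (V.replicate _ 0) l (λ _ → 1)

module TPoly {a} (A : Set a) (0A 1A : A) (_+A_ _*A_ : A → A → A) where

  TP : ℕ → Set a
  TP r = Vec ℕ r → A

  sumA : List A → A
  sumA = L.foldr _+A_ 0A

  _∙_ : ∀ {r} → TP r → TP r → TP r
  (P ∙ Q) δ = sumA (L.map (λ δ' → P δ' *A Q (V.zipWith _∸_ δ δ')) (below δ))

  _⊞_ : ∀ {r} → TP r → TP r → TP r
  (P ⊞ Q) δ = P δ +A Q δ

  oneT : ∀ {r} → TP r
  oneT δ = if eqVᵇ δ (V.replicate _ 0) then 1A else 0A

  mono : ∀ {r} → Fin r → A → TP r
  mono l c δ = if eqVᵇ δ (unitV l) then c else 0A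

  factor : ∀ {r} → Vec A r → TP r
  factor fs = V.foldr′ _⊞_ oneT (V.zipWith mono (V.allFin _) fs)

  -- ∏_{i=1}^n (1 + Σ_l t_l f_l(i))
  genProd : ∀ (n : ℕ) {r} → Vec (Fin n → A) r → TP r
  genProd n fs = V.foldr′ _∙_ oneT (V.map (λ i → factor (V.map (λ f → f i) fs)) (V.allFin n))

  -- e_δ(f_1,…,f_r) : the coefficient of t^δ in the product above
  e : ∀ (n : ℕ) {r} → Vec ℕ r → Vec (Fin n → A) r → A
  e n δ fs = genProd n fs δ

-- Polynomial rings over a commutative ring R: R[V] is the free
-- commutative R-algebra on the variable set V, presented as ring
-- expressions modulo the commutative-R-algebra congruence.

module PolyRing {c ℓ} (R : CommutativeRing c ℓ) where
  open CommutativeRing R using (_≈_; -_; 0#; 1#) renaming (Carrier to K; _+_ to _+ᴿ_; _*_ to _*ᴿ_)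

  infixl 6 _⊕_
  infixl 7 _⊗_
  infix 4 _≋_

  data Pol (X : Set) : Set c where
    con : K → Pol X
    var : X → Pol X
    _⊕_ : Pol X → Pol X → Pol X
    _⊗_ : Pol X → Pol X → Pol X
    ⊖_  : Pol X → Pol X

  data _≋_ {X : Set} : Pol X → Pol X → Set (c ⊔ ℓ) where
    ≋-refl  : ∀ {p} → p ≋ p
    ≋-sym   : ∀ {p q} → p ≋ q → q ≋ p
    ≋-trans : ∀ {p q s} → p ≋ q → q ≋ s → p ≋ s
    ⊕-cong  : ∀ {p p' q q'} → p ≋ p' → q ≋ q' → p ⊕ q ≋ p' ⊕ q'
    ⊗-cong  : ∀ {p p' q q'} → p ≋ p' → q ≋ q' → p ⊗ q ≋ p' ⊗ q'
    ⊖-cong  : ∀ {p q} → p ≋ q → ⊖ p ≋ ⊖ q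
    ⊕-assoc : ∀ p q s → (p ⊕ q) ⊕ s ≋ p ⊕ (q ⊕ s)
    ⊕-comm  : ∀ p q → p ⊕ q ≋ q ⊕ p
    ⊕-idˡ   : ∀ p → con 0# ⊕ p ≋ p
    ⊖-invˡ  : ∀ p → (⊖ p) ⊕ p ≋ con 0#
    ⊗-assoc : ∀ p q s → (p ⊗ q) ⊗ s ≋ p ⊗ (q ⊗ s)
    ⊗-comm  : ∀ p q → p ⊗ q ≋ q ⊗ p
    ⊗-idˡ   : ∀ p → con 1# ⊗ p ≋ p
    ⊗-distribˡ : ∀ p q s → p ⊗ (q ⊕ s) ≋ (p ⊗ q) ⊕ (p ⊗ s)
    con-cong : ∀ {a b} → a ≈ b → con a ≋ con b
    con-+   : ∀ a b → con (a +ᴿ b) ≋ con a ⊕ con b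
    con-*   : ∀ a b → con (a *ᴿ b) ≋ con a ⊗ con b
    con--   : ∀ a → con (- a) ≋ ⊖ con a

  A₁ : ℕ → Set c
  A₁ m = Pol (Fin m)

  -- A_R(n,m) = R[x_i(j) : 1 ≤ i ≤ m, 1 ≤ j ≤ n];  x_i(j) = var (i , j)
  A₂ : ℕ → ℕ → Set c
  A₂ n m = Pol (Fin m × Fin n)

  -- f(j) = f(x_1(j),…,x_m(j))
  at : ∀ {n m} → A₁ m → Fin n → A₂ n m
  at (con a) j = con a
  at (var i) j = var (i , j)
  at (p ⊕ q) j = at p j ⊕ at q j
  at (p ⊗ q) j = at p j ⊗ at q j
  at (⊖ p)   j = ⊖ at p j

  module _ (n m : ℕ) where
    open TPoly (A₂ n m) (con 0#) (con 1#) _⊕_ _⊗_ public using (sumA)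
    open TPoly (A₂ n m) (con 0#) (con 1#) _⊕_ _⊗_ renaming (e to e′)

    eδ : ∀ {r} → Vec ℕ r → Vec (A₁ m) r → A₂ n m
    eδ δ fs = e′ n δ (V.map at fs)

  products : ∀ {m k h} → Vec (A₁ m) k → Vec (A₁ m) h → Vec (A₁ m) (k * h)
  products fs gs = V.concat (V.map (λ f → V.map (λ g → f ⊗ g) gs) fs)

  -- index tuples γ = (γ_{i0})_i , (γ_{0j})_j , (γ_{ij})_{i,j≥1} (row-major)
  Γ : ℕ → ℕ → Set
  Γ k h = Vec ℕ k × Vec ℕ h × Vec (Vec ℕ h) k

  flat : ∀ {k h} → Γ k h → Vec ℕ (k + (h + k * h))
  flat (γF , γG , γFG) = γF V.++ (γG V.++ V.concat γFG)

  admissible : ∀ {k h} (n : ℕ) → Vec ℕ k → Vec ℕ h → Γ k h → Bool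
  admissible {k} {h} n α β (γF , γG , γFG) =
    (V.sum (flat (γF , γG , γFG)) ≤ᵇ n)
    ∧ eqVᵇ (V.zipWith _+_ γF (V.map V.sum γFG)) α
    ∧ eqVᵇ (V.zipWith _+_ γG (V.foldr′ (V.zipWith _+_) (V.replicate h 0) γFG)) β

  -- all tuples γ with all entries ≤ n (a finite superset of the index set)
  candidates : ∀ k h (n : ℕ) → List (Γ k h)
  candidates k h n =
    concatMap (λ γF → concatMap (λ γG → L.map (λ γFG → γF , γG , γFG)
                (allVec k (allVec h (upTo (suc n)))))
              (allVec h (upTo (suc n))))
      (allVec k (upTo (suc n)))

  indexSet : ∀ k h (n : ℕ) → Vec ℕ k → Vec ℕ h → List (Γ k h)
  indexSet k h n α β = filterᵇ (admissible n α β) (candidates k h n)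

-- e_δ(f) is the coefficient of t^δ in ∏_i (1 + Σ_l t_l f_l(i)). Coefficients of such products are
-- handled through the pairing ⟨P, χ⟩ = Σ_δ P_δ χ(δ), which is computed factor by factor. Multiplying
-- the factors for f (variables t) and for g (variables u) gives
--   (1 + Σ_i t_i f_i)(1 + Σ_j u_j g_j) = 1 + Σ_i t_i f_i + Σ_j u_j g_j + Σ_ij t_i u_j f_i g_j,
-- the factor for the family (f, g, fg) under the substitution s_i0 = t_i, s_0j = u_j, s_ij = t_i u_j.
-- Hence e_α(f) e_β(g) is the sum of the e_γ(f, g, fg) over all γ with margins α and β. The bound
-- Σγ ≤ n costs nothing, since a product of n linear factors has no monomial of degree above n.

module Submission where

open import Defs
open import Level using (Level; _⊔_)
open import Algebra.Bundles using (CommutativeRing; CommutativeMonoid)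
open import Data.Bool using (Bool; true; false; if_then_else_; _∧_; T)
import Data.Bool.Properties as Bool
open import Data.Nat using (ℕ; zero; suc; _≡ᵇ_; _≤ᵇ_; _<ᵇ_; _≤_; _<_; s≤s)
import Data.Nat as Nat
import Data.Nat.Properties as ℕₚ
import Data.Fin as Fin
open Fin using (Fin)
open import Data.Product using (_×_; _,_; proj₁; proj₂)
open import Data.List as L using (List; []; _∷_; concatMap; filterᵇ; upTo; map)
open import Data.Vec as V using (Vec; []; _∷_; _++_; sum)
import Data.Vec.Properties as V
open import Data.Vec.Relation.Unary.All as All using (All; []; _∷_)
import Data.Vec.Relation.Unary.All.Properties as Allₚ
open import Relation.Binary.Bundles using (Setoid)
open import Function using (_∘_)
import Data.List.Properties as Lₚ
import Relation.Binary.PropositionalEquality as ≡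
open ≡ using (_≡_; refl; sym; trans; cong; cong₂; module ≡-Reasoning)

module _ {c ℓ} (R : CommutativeRing c ℓ) (X : Set) where
  open PolyRing R
  open CommutativeRing R using (0#; 1#)

  ≋-setoid : Setoid c (c ⊔ ℓ)
  ≋-setoid = record
    { Carrier = Pol X ; _≈_ = _≋_
    ; isEquivalence = record { refl = ≋-refl ; sym = ≋-sym ; trans = ≋-trans } }

  open import Algebra.Consequences.Setoid ≋-setoid
    using (comm∧idˡ⇒id; comm∧invˡ⇒inv; comm∧distrˡ⇒distr)

  Pol-commutativeRing : CommutativeRing c (c ⊔ ℓ)
  Pol-commutativeRing = record
    { Carrier = Pol X ; _≈_ = _≋_ ; _+_ = _⊕_ ; _*_ = _⊗_ ; -_ = ⊖_ ; 0# = con 0# ; 1# = con 1#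
    ; isCommutativeRing = record
      { isRing = record
        { +-isAbelianGroup = record
          { isGroup = record
            { isMonoid = record
              { isSemigroup = record
                { isMagma = record { isEquivalence = Setoid.isEquivalence ≋-setoid ; ∙-cong = ⊕-cong }
                ; assoc = ⊕-assoc }
              ; identity = comm∧idˡ⇒id ⊕-comm ⊕-idˡ }
            ; inverse = comm∧invˡ⇒inv ⊕-comm ⊖-invˡ
            ; ⁻¹-cong = ⊖-cong }
          ; comm = ⊕-comm }
        ; *-cong = ⊗-cong
        ; *-assoc = ⊗-assoc
        ; *-identity = comm∧idˡ⇒id ⊗-comm ⊗-idˡ
        ; distrib = comm∧distrˡ⇒distr ⊕-cong ⊗-comm ⊗-distribˡ }
      ; *-comm = ⊗-comm } }

take-++ : ∀ {A : Set} {a b} (u : Vec A a) (v : Vec A b) → V.take a (u ++ v) ≡ u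
take-++ []      v = refl
take-++ (x ∷ u) v = cong (x ∷_) (take-++ u v)

drop-++ : ∀ {A : Set} {a b} (u : Vec A a) (v : Vec A b) → V.drop a (u ++ v) ≡ v
drop-++ []      v = refl
drop-++ (x ∷ u) v = drop-++ u v

outer : ∀ {a} {A : Set a} {k h} → (A → A → A) → Vec A k → Vec A h → Vec A (k Nat.* h)
outer _∙_ xs ys = V.concat (V.map (λ x → V.map (x ∙_) ys) xs)

map-outer : ∀ {a b} {A : Set a} {B : Set b} {k h} (φ : A → B) {_∙_ : A → A → A} {_∘_ : B → B → B} →
  (∀ x y → φ (x ∙ y) ≡ φ x ∘ φ y) → (xs : Vec A k) (ys : Vec A h) →
  V.map φ (outer _∙_ xs ys) ≡ outer _∘_ (V.map φ xs) (V.map φ ys)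
map-outer φ {_∙_} {_∘_} φ-hom xs ys = begin
  V.map φ (V.concat (V.map (λ x → V.map (x ∙_) ys) xs))
    ≡⟨ V.map-concat φ (V.map (λ x → V.map (x ∙_) ys) xs) ⟩
  V.concat (V.map (V.map φ) (V.map (λ x → V.map (x ∙_) ys) xs))
    ≡⟨ cong V.concat (V.map-∘ (V.map φ) (λ x → V.map (x ∙_) ys) xs) ⟨
  V.concat (V.map (λ x → V.map φ (V.map (x ∙_) ys)) xs)
    ≡⟨ cong V.concat (V.map-cong row xs) ⟩
  V.concat (V.map (λ x → V.map (φ x ∘_) (V.map φ ys)) xs)
    ≡⟨ cong V.concat (V.map-∘ (λ y → V.map (y ∘_) (V.map φ ys)) φ xs) ⟩
  V.concat (V.map (λ y → V.map (y ∘_) (V.map φ ys)) (V.map φ xs)) ∎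
  where
  open ≡-Reasoning
  row : ∀ x → V.map φ (V.map (x ∙_) ys) ≡ V.map (φ x ∘_) (V.map φ ys)
  row x = trans (sym (V.map-∘ φ (x ∙_) ys)) (trans (V.map-cong (φ-hom x) ys) (V.map-∘ (φ x ∘_) φ ys))

zipWith-map : ∀ {a b c d} {A : Set a} {B : Set b} {C : Set c} {D : Set d} {n}
  (f : B → C → D) (g : A → B) (h : A → C) (xs : Vec A n) →
  V.zipWith f (V.map g xs) (V.map h xs) ≡ V.map (λ x → f (g x) (h x)) xs
zipWith-map f g h []       = refl
zipWith-map f g h (x ∷ xs) = cong (f (g x) (h x) ∷_) (zipWith-map f g h xs)

module ExponentVectors where
  open Nat using (_+_; _*_; _∸_)
  open import Algebra.Properties.CommutativeSemigroup ℕₚ.+-commutativeSemigroup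
    using () renaming (interchange to +-interchange)

  0ᵛ : ∀ r → Vec ℕ r
  0ᵛ r = V.replicate r 0

  infixl 6 _+ᵛ_ _∸ᵛ_
  infix 4 _≤ᵛᵇ_

  _+ᵛ_ : ∀ {r} → Vec ℕ r → Vec ℕ r → Vec ℕ r
  _+ᵛ_ = V.zipWith _+_

  _∸ᵛ_ : ∀ {r} → Vec ℕ r → Vec ℕ r → Vec ℕ r
  _∸ᵛ_ = V.zipWith _∸_

  _≤ᵛᵇ_ : ∀ {r} → Vec ℕ r → Vec ℕ r → Bool
  []      ≤ᵛᵇ []      = true
  (a ∷ u) ≤ᵛᵇ (d ∷ δ) = (a ≤ᵇ d) ∧ (u ≤ᵛᵇ δ)

  units : ∀ r → Vec (Vec ℕ r) r
  units zero    = []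
  units (suc r) = (1 ∷ 0ᵛ r) ∷ V.map (0 ∷_) (units r)

  +ᵛ-identityˡ : ∀ {r} (u : Vec ℕ r) → 0ᵛ r +ᵛ u ≡ u
  +ᵛ-identityˡ = V.zipWith-identityˡ ℕₚ.+-identityˡ

  +ᵛ-identityʳ : ∀ {r} (u : Vec ℕ r) → u +ᵛ 0ᵛ r ≡ u
  +ᵛ-identityʳ = V.zipWith-identityʳ ℕₚ.+-identityʳ

  +ᵛ-interchange : ∀ {r} (a b c d : Vec ℕ r) → (a +ᵛ b) +ᵛ (c +ᵛ d) ≡ (a +ᵛ c) +ᵛ (b +ᵛ d)
  +ᵛ-interchange []       []       []       []       = refl
  +ᵛ-interchange (a ∷ as) (b ∷ bs) (c ∷ cs) (d ∷ ds) =
    cong₂ _∷_ (+-interchange a b c d) (+ᵛ-interchange as bs cs ds)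

  ∸ᵛ-identityʳ : ∀ {r} (u : Vec ℕ r) → u ∸ᵛ 0ᵛ r ≡ u
  ∸ᵛ-identityʳ = V.zipWith-identityʳ (λ _ → refl)

  sum-0ᵛ : ∀ r → sum (0ᵛ r) ≡ 0
  sum-0ᵛ zero    = refl
  sum-0ᵛ (suc r) = sum-0ᵛ r

  sum-+ᵛ : ∀ {r} (u v : Vec ℕ r) → sum (u +ᵛ v) ≡ sum u + sum v
  sum-+ᵛ []      []      = refl
  sum-+ᵛ (a ∷ u) (b ∷ v) = trans (cong (a + b +_) (sum-+ᵛ u v)) (+-interchange a b (sum u) (sum v))

  sum-≤⇒all-≤ : ∀ {r n} (u : Vec ℕ r) → sum u ≤ n → All (_≤ n) u
  sum-≤⇒all-≤ []      _  = []
  sum-≤⇒all-≤ (x ∷ u) ≤n = ℕₚ.m+n≤o⇒m≤o x ≤n ∷ sum-≤⇒all-≤ u (ℕₚ.m+n≤o⇒n≤o x ≤n)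

  0ᵛ-++ : ∀ a b → 0ᵛ (a + b) ≡ 0ᵛ a ++ 0ᵛ b
  0ᵛ-++ zero    b = refl
  0ᵛ-++ (suc a) b = cong (0 ∷_) (0ᵛ-++ a b)

  map-unitV : ∀ r → V.map unitV (V.allFin r) ≡ units r
  map-unitV zero    = refl
  map-unitV (suc r) = cong ((1 ∷ 0ᵛ r) ∷_) (begin
    V.map unitV (V.tabulate Fin.suc)           ≡⟨ V.tabulate-∘ unitV Fin.suc ⟨
    V.tabulate (λ l → 0 ∷ unitV l)             ≡⟨ V.tabulate-∘ (0 ∷_) unitV ⟩
    V.map (0 ∷_) (V.tabulate unitV)            ≡⟨ cong (V.map (0 ∷_)) (V.tabulate-allFin unitV) ⟩
    V.map (0 ∷_) (V.map unitV (V.allFin r))    ≡⟨ cong (V.map (0 ∷_)) (map-unitV r) ⟩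
    V.map (0 ∷_) (units r)                     ∎)
    where open ≡-Reasoning

  units-++ : ∀ a b → units (a + b) ≡ V.map (_++ 0ᵛ b) (units a) ++ V.map (0ᵛ a ++_) (units b)
  units-++ zero    b = sym (V.map-id (units b))
  units-++ (suc a) b = cong₂ _∷_ (cong (1 ∷_) (0ᵛ-++ a b)) (begin
    V.map (0 ∷_) (units (a + b))
      ≡⟨ cong (V.map (0 ∷_)) (units-++ a b) ⟩
    V.map (0 ∷_) (V.map (_++ 0ᵛ b) (units a) ++ V.map (0ᵛ a ++_) (units b))
      ≡⟨ V.map-++ (0 ∷_) (V.map (_++ 0ᵛ b) (units a)) _ ⟩
    V.map (0 ∷_) (V.map (_++ 0ᵛ b) (units a)) ++ V.map (0 ∷_) (V.map (0ᵛ a ++_) (units b))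
      ≡⟨ cong₂ _++_ (trans (sym (V.map-∘ (0 ∷_) (_++ 0ᵛ b) (units a)))
                           (V.map-∘ (_++ 0ᵛ b) (0 ∷_) (units a)))
                    (sym (V.map-∘ (0 ∷_) (0ᵛ a ++_) (units b))) ⟩
    V.map (_++ 0ᵛ b) (V.map (0 ∷_) (units a)) ++ V.map (0ᵛ (suc a) ++_) (units b) ∎)
    where open ≡-Reasoning

  units-sum : ∀ r → All (λ u → sum u ≡ 1) (units r)
  units-sum zero    = []
  units-sum (suc r) = cong suc (sum-0ᵛ r) ∷ Allₚ.map⁺ (units-sum r)

  0ᵛ-≤ᵛᵇ : ∀ {r} (δ : Vec ℕ r) → (0ᵛ r ≤ᵛᵇ δ) ≡ true
  0ᵛ-≤ᵛᵇ []      = refl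
  0ᵛ-≤ᵛᵇ (d ∷ δ) = 0ᵛ-≤ᵛᵇ δ

  <ᵇ-suc : ∀ u d → (u <ᵇ suc d) ≡ (u ≤ᵇ d)
  <ᵇ-suc zero    d = refl
  <ᵇ-suc (suc u) d = refl

  ≡ᵇ-+ : ∀ d u s → (d ≡ᵇ u + s) ≡ (u ≤ᵇ d) ∧ (d ∸ u ≡ᵇ s)
  ≡ᵇ-+ d       zero    s = refl
  ≡ᵇ-+ zero    (suc u) s = refl
  ≡ᵇ-+ (suc d) (suc u) s = trans (≡ᵇ-+ d u s) (cong (_∧ (d ∸ u ≡ᵇ s)) (sym (<ᵇ-suc u d)))

  eqVᵇ-+ᵛ : ∀ {r} (δ u s : Vec ℕ r) → eqVᵇ δ (u +ᵛ s) ≡ (u ≤ᵛᵇ δ) ∧ eqVᵇ (δ ∸ᵛ u) s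
  eqVᵇ-+ᵛ []      []      []      = refl
  eqVᵇ-+ᵛ (d ∷ δ) (a ∷ u) (x ∷ s) =
    trans (cong₂ _∧_ (≡ᵇ-+ d a x) (eqVᵇ-+ᵛ δ u s)) (∧-interchange (a ≤ᵇ d) _ _ _)
    where open import Algebra.Properties.CommutativeSemigroup
            (CommutativeMonoid.commutativeSemigroup Bool.∧-commutativeMonoid)
            renaming (interchange to ∧-interchange)

  eqVᵇ-++ : ∀ {a b} (u c : Vec ℕ a) (v d : Vec ℕ b) → eqVᵇ (u ++ v) (c ++ d) ≡ eqVᵇ u c ∧ eqVᵇ v d
  eqVᵇ-++ []      []      v d = refl
  eqVᵇ-++ (x ∷ u) (y ∷ c) v d with x ≡ᵇ y
  ... | true  = eqVᵇ-++ u c v d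
  ... | false = refl

  eqVᵇ-comm : ∀ {r} (u v : Vec ℕ r) → eqVᵇ u v ≡ eqVᵇ v u
  eqVᵇ-comm []      []      = refl
  eqVᵇ-comm (x ∷ u) (y ∷ v) = cong₂ _∧_ (≡ᵇ-comm x y) (eqVᵇ-comm u v)
    where
    ≡ᵇ-comm : ∀ x y → (x ≡ᵇ y) ≡ (y ≡ᵇ x)
    ≡ᵇ-comm zero    zero    = refl
    ≡ᵇ-comm zero    (suc y) = refl
    ≡ᵇ-comm (suc x) zero    = refl
    ≡ᵇ-comm (suc x) (suc y) = ≡ᵇ-comm x y

  matrix : ∀ k h → Vec ℕ (k * h) → Vec (Vec ℕ h) k
  matrix k h e = proj₁ (V.group k h e)

  matrix-++ : ∀ k h (v : Vec ℕ h) (e : Vec ℕ (k * h)) → matrix (suc k) h (v ++ e) ≡ v ∷ matrix k h e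
  matrix-++ k h v e = cong₂ _∷_ (take-++ v e) (cong (matrix k h) (drop-++ v e))

  matrix-+ᵛ : ∀ k h (e e′ : Vec ℕ (k * h)) →
    matrix k h (e +ᵛ e′) ≡ V.zipWith _+ᵛ_ (matrix k h e) (matrix k h e′)
  matrix-+ᵛ zero    h [] []  = refl
  matrix-+ᵛ (suc k) h e  e′ = cong₂ _∷_ (V.take-zipWith _+_ e e′)
    (trans (cong (matrix k h) (V.drop-zipWith _+_ e e′)) (matrix-+ᵛ k h _ _))

  rowSums : ∀ {k h} → Vec (Vec ℕ h) k → Vec ℕ k
  rowSums = V.map sum

  columnSums : ∀ {k h} → Vec (Vec ℕ h) k → Vec ℕ h
  columnSums {h = h} = V.foldr′ _+ᵛ_ (0ᵛ h)

  rowSums-matrix-0ᵛ : ∀ k h → rowSums (matrix k h (0ᵛ (k * h))) ≡ 0ᵛ k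
  rowSums-matrix-0ᵛ zero    h = refl
  rowSums-matrix-0ᵛ (suc k) h = trans (cong (rowSums ∘ matrix (suc k) h) (0ᵛ-++ h (k * h)))
    (trans (cong rowSums (matrix-++ k h (0ᵛ h) (0ᵛ (k * h)))) (cong₂ _∷_ (sum-0ᵛ h) (rowSums-matrix-0ᵛ k h)))

  columnSums-matrix-0ᵛ : ∀ k h → columnSums (matrix k h (0ᵛ (k * h))) ≡ 0ᵛ h
  columnSums-matrix-0ᵛ zero    h = refl
  columnSums-matrix-0ᵛ (suc k) h = trans (cong (columnSums ∘ matrix (suc k) h) (0ᵛ-++ h (k * h)))
    (trans (cong columnSums (matrix-++ k h (0ᵛ h) (0ᵛ (k * h))))
      (trans (cong (0ᵛ h +ᵛ_) (columnSums-matrix-0ᵛ k h)) (+ᵛ-identityˡ (0ᵛ h))))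

  rowSums-+ : ∀ {k h} (M N : Vec (Vec ℕ h) k) → rowSums (V.zipWith _+ᵛ_ M N) ≡ rowSums M +ᵛ rowSums N
  rowSums-+ []      []      = refl
  rowSums-+ (u ∷ M) (v ∷ N) = cong₂ _∷_ (sum-+ᵛ u v) (rowSums-+ M N)

  columnSums-+ : ∀ {k h} (M N : Vec (Vec ℕ h) k) →
    columnSums (V.zipWith _+ᵛ_ M N) ≡ columnSums M +ᵛ columnSums N
  columnSums-+ {h = h} []      []      = sym (+ᵛ-identityˡ (0ᵛ h))
  columnSums-+         (u ∷ M) (v ∷ N) =
    trans (cong (u +ᵛ v +ᵛ_) (columnSums-+ M N)) (+ᵛ-interchange u v (columnSums M) (columnSums N))

  dim : ℕ → ℕ → ℕ
  dim k h = k + (h + k * h)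

  module _ (k h : ℕ) where

    fBlock : Vec ℕ (dim k h) → Vec ℕ k
    fBlock s = V.take k s

    gBlock : Vec ℕ (dim k h) → Vec ℕ h
    gBlock s = V.take h (V.drop k s)

    fgBlock : Vec ℕ (dim k h) → Vec (Vec ℕ h) k
    fgBlock s = matrix k h (V.drop h (V.drop k s))

    -- A vector s of length dim k h is γ flattened as in flat; fMargin s and gMargin s are
    -- (γ_i0 + Σ_j γ_ij)_i and (γ_0j + Σ_i γ_ij)_j.
    fMargin : Vec ℕ (dim k h) → Vec ℕ k
    fMargin s = fBlock s +ᵛ rowSums (fgBlock s)

    gMargin : Vec ℕ (dim k h) → Vec ℕ h
    gMargin s = gBlock s +ᵛ columnSums (fgBlock s)

    blocks-++ : ∀ s → fBlock s ++ (gBlock s ++ V.concat (fgBlock s)) ≡ s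
    blocks-++ s = trans
      (cong (V.take k s ++_) (trans (cong (gBlock s ++_) (sym (proj₂ (V.group k h _))))
                                    (V.take++drop≡id h (V.drop k s))))
      (V.take++drop≡id k s)

    module _ (a : Vec ℕ k) (b : Vec ℕ h) (e : Vec ℕ (k * h)) where

      fBlock-++ : fBlock (a ++ (b ++ e)) ≡ a
      fBlock-++ = take-++ a _

      gBlock-++ : gBlock (a ++ (b ++ e)) ≡ b
      gBlock-++ = trans (cong (V.take h) (drop-++ a (b ++ e))) (take-++ b e)

      fgBlock-++ : fgBlock (a ++ (b ++ e)) ≡ matrix k h e
      fgBlock-++ = cong (matrix k h) (trans (cong (V.drop h) (drop-++ a (b ++ e))) (drop-++ b e))

    module _ (s t : Vec ℕ (dim k h)) where

      fBlock-+ᵛ : fBlock (s +ᵛ t) ≡ fBlock s +ᵛ fBlock t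
      fBlock-+ᵛ = V.take-zipWith {m = k} _+_ s t

      gBlock-+ᵛ : gBlock (s +ᵛ t) ≡ gBlock s +ᵛ gBlock t
      gBlock-+ᵛ = trans (cong (V.take h) (V.drop-zipWith {m = k} _+_ s t)) (V.take-zipWith {m = h} _+_ _ _)

      fgBlock-+ᵛ : fgBlock (s +ᵛ t) ≡ V.zipWith _+ᵛ_ (fgBlock s) (fgBlock t)
      fgBlock-+ᵛ = trans
        (cong (matrix k h) (trans (cong (V.drop h) (V.drop-zipWith {m = k} _+_ s t)) (V.drop-zipWith {m = h} _+_ _ _)))
        (matrix-+ᵛ k h _ _)

      fMargin-+ᵛ : fMargin (s +ᵛ t) ≡ fMargin s +ᵛ fMargin t
      fMargin-+ᵛ = trans (cong₂ _+ᵛ_ fBlock-+ᵛ (trans (cong rowSums fgBlock-+ᵛ) (rowSums-+ (fgBlock s) _)))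
                         (+ᵛ-interchange _ _ _ _)

      gMargin-+ᵛ : gMargin (s +ᵛ t) ≡ gMargin s +ᵛ gMargin t
      gMargin-+ᵛ = trans (cong₂ _+ᵛ_ gBlock-+ᵛ (trans (cong columnSums fgBlock-+ᵛ) (columnSums-+ (fgBlock s) _)))
                         (+ᵛ-interchange _ _ _ _)

    fMargin-++ : ∀ (a : Vec ℕ k) (b : Vec ℕ h) e → fMargin (a ++ (b ++ e)) ≡ a +ᵛ rowSums (matrix k h e)
    fMargin-++ a b e = cong₂ _+ᵛ_ (fBlock-++ a b e) (cong rowSums (fgBlock-++ a b e))

    gMargin-++ : ∀ (a : Vec ℕ k) (b : Vec ℕ h) e → gMargin (a ++ (b ++ e)) ≡ b +ᵛ columnSums (matrix k h e)
    gMargin-++ a b e = cong₂ _+ᵛ_ (gBlock-++ a b e) (cong columnSums (fgBlock-++ a b e))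

    fMargin-++-0ᵛ : ∀ (a : Vec ℕ k) (b : Vec ℕ h) → fMargin (a ++ (b ++ 0ᵛ (k * h))) ≡ a
    fMargin-++-0ᵛ a b = trans (fMargin-++ a b _) (trans (cong (a +ᵛ_) (rowSums-matrix-0ᵛ k h)) (+ᵛ-identityʳ a))

    gMargin-++-0ᵛ : ∀ (a : Vec ℕ k) (b : Vec ℕ h) → gMargin (a ++ (b ++ 0ᵛ (k * h))) ≡ b
    gMargin-++-0ᵛ a b = trans (gMargin-++ a b _) (trans (cong (b +ᵛ_) (columnSums-matrix-0ᵛ k h)) (+ᵛ-identityʳ b))

    0ᵛ-blocks : 0ᵛ (dim k h) ≡ 0ᵛ k ++ (0ᵛ h ++ 0ᵛ (k * h))
    0ᵛ-blocks = trans (0ᵛ-++ k _) (cong (0ᵛ k ++_) (0ᵛ-++ h (k * h)))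

    fMargin-0ᵛ : fMargin (0ᵛ (dim k h)) ≡ 0ᵛ k
    fMargin-0ᵛ = trans (cong fMargin 0ᵛ-blocks) (fMargin-++-0ᵛ (0ᵛ k) (0ᵛ h))

    gMargin-0ᵛ : gMargin (0ᵛ (dim k h)) ≡ 0ᵛ h
    gMargin-0ᵛ = trans (cong gMargin 0ᵛ-blocks) (gMargin-++-0ᵛ (0ᵛ k) (0ᵛ h))

open ExponentVectors

module Sums {c ℓ} (CR : CommutativeRing c ℓ) where
  open CommutativeRing CR
    renaming (Carrier to A; refl to ≈-refl; sym to ≈-sym; trans to ≈-trans; reflexive to ≈-reflexive)
  open import Relation.Binary.Reasoning.Setoid setoid
  open import Algebra.Properties.CommutativeSemigroup +-commutativeSemigroup
    using () renaming (interchange to +-interchange)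

  if0 : Bool → A → A
  if0 b x = if b then x else 0#

  [_] : Bool → A
  [ b ] = if0 b 1#

  if0-cong : ∀ b {x y} → x ≈ y → if0 b x ≈ if0 b y
  if0-cong true  x≈y = x≈y
  if0-cong false _   = ≈-refl

  if0-∧ : ∀ a b (x : A) → if0 (a ∧ b) x ≡ if0 a (if0 b x)
  if0-∧ true  b x = refl
  if0-∧ false b x = refl

  if0-T : ∀ {b} (x : A) → T b → if0 b x ≡ x
  if0-T {true} x _ = refl

  if0-indicator-comm : ∀ a b → if0 a [ b ] ≡ if0 b [ a ]
  if0-indicator-comm true  true  = refl
  if0-indicator-comm true  false = refl
  if0-indicator-comm false true  = refl
  if0-indicator-comm false false = refl

  indicator-* : ∀ b x → [ b ] * x ≈ if0 b x
  indicator-* true  x = *-identityˡ x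
  indicator-* false x = zeroˡ x

  indicator-∧ : ∀ a b → [ a ∧ b ] ≈ [ a ] * [ b ]
  indicator-∧ true  b = ≈-sym (indicator-* true [ b ])
  indicator-∧ false b = ≈-sym (indicator-* false [ b ])

  Σ : ∀ {B : Set} → List B → (B → A) → A
  Σ xs φ = L.foldr _+_ 0# (L.map φ xs)

  module _ {B : Set} where

    Σ-cong : ∀ (xs : List B) {φ ψ : B → A} → (∀ x → φ x ≈ ψ x) → Σ xs φ ≈ Σ xs ψ
    Σ-cong []       φ≈ψ = ≈-refl
    Σ-cong (x ∷ xs) φ≈ψ = +-cong (φ≈ψ x) (Σ-cong xs φ≈ψ)

    Σ-0 : ∀ (xs : List B) → Σ xs (λ _ → 0#) ≈ 0#
    Σ-0 []       = ≈-refl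
    Σ-0 (x ∷ xs) = ≈-trans (+-identityˡ _) (Σ-0 xs)

    Σ-+ : ∀ (xs : List B) (φ ψ : B → A) → Σ xs (λ x → φ x + ψ x) ≈ Σ xs φ + Σ xs ψ
    Σ-+ []       φ ψ = ≈-sym (+-identityˡ 0#)
    Σ-+ (x ∷ xs) φ ψ = ≈-trans (+-congˡ (Σ-+ xs φ ψ)) (+-interchange _ _ _ _)

    Σ-++ : ∀ (xs ys : List B) (φ : B → A) → Σ (xs L.++ ys) φ ≈ Σ xs φ + Σ ys φ
    Σ-++ []       ys φ = ≈-sym (+-identityˡ _)
    Σ-++ (x ∷ xs) ys φ = ≈-trans (+-congˡ (Σ-++ xs ys φ)) (≈-sym (+-assoc _ _ _))

    Σ-if0 : ∀ b (xs : List B) (φ : B → A) → Σ xs (λ x → if0 b (φ x)) ≈ if0 b (Σ xs φ)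
    Σ-if0 true  xs φ = ≈-refl
    Σ-if0 false xs φ = Σ-0 xs

    Σ-filter : ∀ (p : B → Bool) (xs : List B) (φ : B → A) →
      Σ (filterᵇ p xs) φ ≈ Σ xs (λ x → if0 (p x) (φ x))
    Σ-filter p []       φ = ≈-refl
    Σ-filter p (x ∷ xs) φ with p x
    ... | true  = +-congˡ (Σ-filter p xs φ)
    ... | false = ≈-trans (Σ-filter p xs φ) (≈-sym (+-identityˡ _))

    Σ-map : ∀ {C : Set} (g : C → B) (xs : List C) (φ : B → A) → Σ (L.map g xs) φ ≈ Σ xs (λ x → φ (g x))
    Σ-map g []       φ = ≈-refl
    Σ-map g (x ∷ xs) φ = +-congˡ (Σ-map g xs φ)

    Σ-concatMap : ∀ {C : Set} (f : C → List B) (xs : List C) (φ : B → A) →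
      Σ (concatMap f xs) φ ≈ Σ xs (λ x → Σ (f x) φ)
    Σ-concatMap f []       φ = ≈-refl
    Σ-concatMap f (x ∷ xs) φ = ≈-trans (Σ-++ (f x) (concatMap f xs) φ) (+-congˡ (Σ-concatMap f xs φ))

  Σ-∷-product : ∀ {B : Set} {r} (xs : List B) (ys : List (Vec B r)) (φ : Vec B (suc r) → A) →
    Σ (concatMap (λ x → L.map (x ∷_) ys) xs) φ ≈ Σ xs (λ x → Σ ys (λ y → φ (x ∷ y)))
  Σ-∷-product xs ys φ = ≈-trans (Σ-concatMap _ xs φ) (Σ-cong xs (λ x → Σ-map (x ∷_) ys φ))

  Σ-∷-if0 : ∀ {B : Set} {r} (xs : List B) (ys : List (Vec B r)) (p : B → Bool) (q : Vec B r → Bool)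
    (ψ : Vec B (suc r) → A) {φ : Vec B (suc r) → A} →
    (∀ x y → φ (x ∷ y) ≡ if0 (p x ∧ q y) (ψ (x ∷ y))) →
    Σ (concatMap (λ x → L.map (x ∷_) ys) xs) φ
      ≈ Σ xs (λ x → if0 (p x) (Σ ys (λ y → if0 (q y) (ψ (x ∷ y)))))
  Σ-∷-if0 xs ys p q ψ φ≡ψ = ≈-trans (Σ-∷-product xs ys _) (Σ-cong xs (λ x →
    ≈-trans (Σ-cong ys (λ y → ≈-reflexive (≡.trans (φ≡ψ x y) (if0-∧ (p x) (q y) _)))) (Σ-if0 (p x) ys _)))

  Σ-upTo-≡ᵇ : ∀ N a (ψ : ℕ → A) → Σ (upTo N) (λ i → if0 (i ≡ᵇ a) (ψ i)) ≈ if0 (a <ᵇ N) (ψ a)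
  Σ-upTo-≡ᵇ zero    a       ψ = ≈-refl
  Σ-upTo-≡ᵇ (suc N) a       ψ = ≈-trans (+-congˡ (≈-trans
      (≈-reflexive (cong (λ is → Σ is (λ i → if0 (i ≡ᵇ a) (ψ i))) (≡.sym (Lₚ.map-upTo suc N))))
      (Σ-map suc (upTo N) _)))
    (go a)
    where
    go : ∀ a → if0 (0 ≡ᵇ a) (ψ 0) + Σ (upTo N) (λ i → if0 (suc i ≡ᵇ a) (ψ (suc i)))
             ≈ if0 (a <ᵇ suc N) (ψ a)
    go zero    = ≈-trans (+-congˡ (Σ-0 (upTo N))) (+-identityʳ _)
    go (suc a) = ≈-trans (+-identityˡ _) (Σ-upTo-≡ᵇ N a (ψ ∘ suc))

  -- xs contains b exactly once, as seen by _≟_.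
  Selects : ∀ {B : Set} → (B → B → Bool) → List B → B → Set (c ⊔ ℓ)
  Selects {B} _≟_ xs b = ∀ (ψ : B → A) → Σ xs (λ x → if0 (x ≟ b) (ψ x)) ≈ ψ b

  upTo-selects : ∀ {N a} → a < N → Selects _≡ᵇ_ (upTo N) a
  upTo-selects {N} {a} a<N ψ = ≈-trans (Σ-upTo-≡ᵇ N a ψ) (≈-reflexive (if0-T (ψ a) (ℕₚ.<⇒<ᵇ a<N)))

  module _ {B : Set} {_≟_ : B → B → Bool} {xs : List B} (_≟ᵛ_ : ∀ {r} → Vec B r → Vec B r → Bool)
           (≟ᵛ-[] : ([] ≟ᵛ []) ≡ true)
           (≟ᵛ-∷ : ∀ {r} x y (u v : Vec B r) → ((x ∷ u) ≟ᵛ (y ∷ v)) ≡ (x ≟ y) ∧ (u ≟ᵛ v)) where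

    allVec-selects : ∀ {r} {b : Vec B r} → All (Selects _≟_ xs) b → Selects _≟ᵛ_ (allVec r xs) b
    allVec-selects {b = []}    []         ψ =
      ≈-trans (+-identityʳ _) (≈-reflexive (cong (λ t → if0 t (ψ [])) ≟ᵛ-[]))
    allVec-selects {b = y ∷ b} (y-sel ∷ b-sel) ψ = begin
      Σ (allVec _ xs) (λ x → if0 (x ≟ᵛ (y ∷ b)) (ψ x))
        ≈⟨ Σ-∷-if0 xs (allVec _ xs) (_≟ y) (_≟ᵛ b) ψ
             (λ x u → cong (λ t → if0 t (ψ (x ∷ u))) (≟ᵛ-∷ x y u b)) ⟩
      Σ xs (λ x → if0 (x ≟ y) (Σ (allVec _ xs) (λ u → if0 (u ≟ᵛ b) (ψ (x ∷ u)))))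
        ≈⟨ Σ-cong xs (λ x → if0-cong (x ≟ y) (allVec-selects b-sel (λ u → ψ (x ∷ u)))) ⟩
      Σ xs (λ x → if0 (x ≟ y) (ψ (x ∷ b)))
        ≈⟨ y-sel (λ x → ψ (x ∷ b)) ⟩
      ψ (y ∷ b) ∎

  Σ-below-eqVᵇ : ∀ {r} (δ u : Vec ℕ r) (ψ : Vec ℕ r → A) →
    Σ (below δ) (λ δ′ → if0 (eqVᵇ δ′ u) (ψ δ′)) ≈ if0 (u ≤ᵛᵇ δ) (ψ u)
  Σ-below-eqVᵇ []      []      ψ = +-identityʳ _
  Σ-below-eqVᵇ (d ∷ δ) (a ∷ u) ψ = begin
    Σ (below (d ∷ δ)) (λ δ′ → if0 (eqVᵇ δ′ (a ∷ u)) (ψ δ′))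
      ≈⟨ Σ-∷-if0 (upTo (suc d)) (below δ) (_≡ᵇ a) (λ δ′ → eqVᵇ δ′ u) ψ (λ _ _ → refl) ⟩
    Σ (upTo (suc d)) (λ i → if0 (i ≡ᵇ a) (Σ (below δ) (λ δ′ → if0 (eqVᵇ δ′ u) (ψ (i ∷ δ′)))))
      ≈⟨ Σ-cong (upTo (suc d)) (λ i → if0-cong (i ≡ᵇ a) (Σ-below-eqVᵇ δ u (λ δ′ → ψ (i ∷ δ′)))) ⟩
    Σ (upTo (suc d)) (λ i → if0 (i ≡ᵇ a) (if0 (u ≤ᵛᵇ δ) (ψ (i ∷ u))))
      ≈⟨ Σ-upTo-≡ᵇ (suc d) a _ ⟩
    if0 (a <ᵇ suc d) (if0 (u ≤ᵛᵇ δ) (ψ (a ∷ u)))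
      ≡⟨ ≡.trans (cong (λ t → if0 t _) (<ᵇ-suc a d)) (≡.sym (if0-∧ (a ≤ᵇ d) (u ≤ᵛᵇ δ) _)) ⟩
    if0 ((a ∷ u) ≤ᵛᵇ (d ∷ δ)) (ψ (a ∷ u)) ∎

  module _ {n : ℕ} where

    entry-selects : ∀ {x} → x ≤ n → Selects _≡ᵇ_ (upTo (suc n)) x
    entry-selects x≤n = upTo-selects (s≤s x≤n)

    row-selects : ∀ {r} {u : Vec ℕ r} → All (_≤ n) u → Selects eqVᵇ (allVec r (upTo (suc n))) u
    row-selects u≤n = allVec-selects eqVᵇ refl (λ _ _ _ _ → refl) (All.map entry-selects u≤n)

    matrix-selects : ∀ {k h} {M : Vec (Vec ℕ h) k} → All (All (_≤ n)) M →
      Selects (λ M′ M → eqVᵇ (V.concat M′) (V.concat M)) (allVec k (allVec h (upTo (suc n)))) M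
    matrix-selects M≤n = allVec-selects (λ M′ M → eqVᵇ (V.concat M′) (V.concat M)) refl
      (λ u v M′ M → eqVᵇ-++ u v (V.concat M′) (V.concat M)) (All.map row-selects M≤n)

  weightedSum : ∀ {P : Set} {r} → Vec P r → Vec A r → (P → A) → A
  weightedSum []       []       ψ = 0#
  weightedSum (p ∷ ps) (x ∷ xs) ψ = x * ψ p + weightedSum ps xs ψ

  module _ {P : Set} where

    weightedSum-cong-All : ∀ {r} {Q : P → Set} {ps : Vec P r} (xs : Vec A r) {ψ ψ′ : P → A} →
      All Q ps → (∀ p → Q p → ψ p ≈ ψ′ p) → weightedSum ps xs ψ ≈ weightedSum ps xs ψ′
    weightedSum-cong-All []       []         ψ≈ψ′ = ≈-refl
    weightedSum-cong-All (x ∷ xs) (qp ∷ qps) ψ≈ψ′ =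
      +-cong (*-congˡ (ψ≈ψ′ _ qp)) (weightedSum-cong-All xs qps ψ≈ψ′)

    weightedSum-cong : ∀ {r} (ps : Vec P r) (xs : Vec A r) {ψ ψ′ : P → A} →
      (∀ p → ψ p ≈ ψ′ p) → weightedSum ps xs ψ ≈ weightedSum ps xs ψ′
    weightedSum-cong []       []       ψ≈ψ′ = ≈-refl
    weightedSum-cong (p ∷ ps) (x ∷ xs) ψ≈ψ′ = +-cong (*-congˡ (ψ≈ψ′ p)) (weightedSum-cong ps xs ψ≈ψ′)

    weightedSum-0 : ∀ {r} (ps : Vec P r) (xs : Vec A r) → weightedSum ps xs (λ _ → 0#) ≈ 0#
    weightedSum-0 []       []       = ≈-refl
    weightedSum-0 (p ∷ ps) (x ∷ xs) =
      ≈-trans (+-cong (zeroʳ x) (weightedSum-0 ps xs)) (+-identityˡ 0#)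

    weightedSum-+ : ∀ {r} (ps : Vec P r) (xs : Vec A r) (ψ ψ′ : P → A) →
      weightedSum ps xs (λ p → ψ p + ψ′ p) ≈ weightedSum ps xs ψ + weightedSum ps xs ψ′
    weightedSum-+ []       []       ψ ψ′ = ≈-sym (+-identityˡ 0#)
    weightedSum-+ (p ∷ ps) (x ∷ xs) ψ ψ′ =
      ≈-trans (+-cong (distribˡ x _ _) (weightedSum-+ ps xs ψ ψ′)) (+-interchange _ _ _ _)

    weightedSum-*ˡ : ∀ {r} a (ps : Vec P r) (xs : Vec A r) (ψ : P → A) →
      a * weightedSum ps xs ψ ≈ weightedSum ps xs (λ p → a * ψ p)
    weightedSum-*ˡ a []       []       ψ = zeroʳ a
    weightedSum-*ˡ a (p ∷ ps) (x ∷ xs) ψ =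
      ≈-trans (distribˡ a _ _) (+-cong (x∙yz≈y∙xz a x (ψ p)) (weightedSum-*ˡ a ps xs ψ))
      where open import Algebra.Properties.CommutativeSemigroup *-commutativeSemigroup using (x∙yz≈y∙xz)

    weightedSum-*ʳ : ∀ {r} a (ps : Vec P r) (xs : Vec A r) (ψ : P → A) →
      weightedSum ps xs ψ * a ≈ weightedSum ps xs (λ p → ψ p * a)
    weightedSum-*ʳ a []       []       ψ = zeroˡ a
    weightedSum-*ʳ a (p ∷ ps) (x ∷ xs) ψ =
      ≈-trans (distribʳ a _ _) (+-cong (*-assoc x (ψ p) a) (weightedSum-*ʳ a ps xs ψ))

    weightedSum-scale : ∀ {r} a (ps : Vec P r) (xs : Vec A r) (ψ : P → A) →
      weightedSum ps (V.map (a *_) xs) ψ ≈ a * weightedSum ps xs ψ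
    weightedSum-scale a []       []       ψ = ≈-sym (zeroʳ a)
    weightedSum-scale a (p ∷ ps) (x ∷ xs) ψ =
      ≈-trans (+-cong (*-assoc a x (ψ p)) (weightedSum-scale a ps xs ψ)) (≈-sym (distribˡ a _ _))

    weightedSum-++ : ∀ {r s} (ps : Vec P r) (qs : Vec P s) (xs : Vec A r) (ys : Vec A s) (ψ : P → A) →
      weightedSum (ps ++ qs) (xs ++ ys) ψ ≈ weightedSum ps xs ψ + weightedSum qs ys ψ
    weightedSum-++ []       qs []       ys ψ = ≈-sym (+-identityˡ _)
    weightedSum-++ (p ∷ ps) qs (x ∷ xs) ys ψ =
      ≈-trans (+-congˡ (weightedSum-++ ps qs xs ys ψ)) (≈-sym (+-assoc _ _ _))

    weightedSum-map : ∀ {Q : Set} {r} (g : Q → P) (qs : Vec Q r) (xs : Vec A r) (ψ : P → A) →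
      weightedSum (V.map g qs) xs ψ ≡ weightedSum qs xs (ψ ∘ g)
    weightedSum-map g []       []       ψ = refl
    weightedSum-map g (q ∷ qs) (x ∷ xs) ψ = cong (x * ψ (g q) +_) (weightedSum-map g qs xs ψ)

    Σ-weightedSum : ∀ {B : Set} {r} (bs : List B) (ps : Vec P r) (xs : Vec A r) (φ : B → P → A) →
      Σ bs (λ b → weightedSum ps xs (φ b)) ≈ weightedSum ps xs (λ p → Σ bs (λ b → φ b p))
    Σ-weightedSum []       ps xs φ = ≈-sym (weightedSum-0 ps xs)
    Σ-weightedSum (b ∷ bs) ps xs φ =
      ≈-trans (+-congˡ (Σ-weightedSum bs ps xs φ)) (≈-sym (weightedSum-+ ps xs (φ b) _))

  weightedSum-* : ∀ {P Q : Set} {r s} (ps : Vec P r) (xs : Vec A r) (qs : Vec Q s) (ys : Vec A s)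
    (ψ : P → A) (χ : Q → A) →
    weightedSum ps xs ψ * weightedSum qs ys χ ≈ weightedSum ps xs (λ p → weightedSum qs ys (λ q → ψ p * χ q))
  weightedSum-* ps xs qs ys ψ χ = ≈-trans (weightedSum-*ʳ _ ps xs ψ)
    (weightedSum-cong ps xs (λ p → weightedSum-*ˡ (ψ p) qs ys χ))

  linear : ∀ {r} → Vec A r → (Vec ℕ r → A) → A
  linear {r} = weightedSum (units r)

  linear-∷ : ∀ {r} x (xs : Vec A r) (ψ : Vec ℕ (suc r) → A) →
    linear (x ∷ xs) ψ ≡ x * ψ (1 ∷ 0ᵛ r) + linear xs (λ u → ψ (0 ∷ u))
  linear-∷ {r} x xs ψ = cong (x * ψ (1 ∷ 0ᵛ r) +_) (weightedSum-map (0 ∷_) (units r) xs ψ)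

  linear-++ : ∀ {r s} (xs : Vec A r) (ys : Vec A s) (ψ : Vec ℕ (r Nat.+ s) → A) →
    linear (xs ++ ys) ψ ≈ linear xs (λ u → ψ (u ++ 0ᵛ s)) + linear ys (λ v → ψ (0ᵛ r ++ v))
  linear-++ {r} {s} xs ys ψ = begin
    weightedSum (units (r Nat.+ s)) (xs ++ ys) ψ
      ≡⟨ cong (λ us → weightedSum us (xs ++ ys) ψ) (units-++ r s) ⟩
    weightedSum (V.map (_++ 0ᵛ s) (units r) ++ V.map (0ᵛ r ++_) (units s)) (xs ++ ys) ψ
      ≈⟨ weightedSum-++ (V.map (_++ 0ᵛ s) (units r)) _ xs ys ψ ⟩
    weightedSum (V.map (_++ 0ᵛ s) (units r)) xs ψ + weightedSum (V.map (0ᵛ r ++_) (units s)) ys ψ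
      ≡⟨ cong₂ _+_ (weightedSum-map _ (units r) xs ψ) (weightedSum-map _ (units s) ys ψ) ⟩
    linear xs (λ u → ψ (u ++ 0ᵛ s)) + linear ys (λ v → ψ (0ᵛ r ++ v)) ∎

  linear-cong-units : ∀ {r} (xs : Vec A r) {ψ ψ′ : Vec ℕ r → A} →
    (∀ u → sum u ≡ 1 → ψ u ≈ ψ′ u) → linear xs ψ ≈ linear xs ψ′
  linear-cong-units {r} xs = weightedSum-cong-All xs (units-sum r)

module Expansion {c ℓ} (CR : CommutativeRing c ℓ) where
  open CommutativeRing CR
    renaming (Carrier to A; refl to ≈-refl; sym to ≈-sym; trans to ≈-trans; reflexive to ≈-reflexive)
  open Sums CR
  open TPoly A 0# 1# _+_ _*_
  open import Relation.Binary.Reasoning.Setoid setoid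
  open import Algebra.Properties.CommutativeSemigroup +-commutativeSemigroup
    using (xy∙z≈y∙zx) renaming (interchange to +-interchange)

  -- pairing rs χ = Σ_δ (coefficient of t^δ in ∏_i (1 + Σ_l rs_il t_l)) · χ δ
  pairing : ∀ {r n} → Vec (Vec A r) n → (Vec ℕ r → A) → A
  pairing {r} []       χ = χ (0ᵛ r)
  pairing     (c ∷ rs) χ = linear c (λ u → pairing rs (λ s → χ (u +ᵛ s))) + pairing rs χ

  module _ {r : ℕ} where

    pairing-cong : ∀ {n} (rs : Vec (Vec A r) n) {χ χ′ : Vec ℕ r → A} →
      (∀ s → χ s ≈ χ′ s) → pairing rs χ ≈ pairing rs χ′
    pairing-cong []       χ≈χ′ = χ≈χ′ _
    pairing-cong (c ∷ rs) χ≈χ′ = +-cong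
      (weightedSum-cong (units r) c (λ u → pairing-cong rs (λ s → χ≈χ′ (u +ᵛ s)))) (pairing-cong rs χ≈χ′)

    pairing-cong-≤ : ∀ {n} (rs : Vec (Vec A r) n) {χ χ′ : Vec ℕ r → A} →
      (∀ s → sum s ≤ n → χ s ≈ χ′ s) → pairing rs χ ≈ pairing rs χ′
    pairing-cong-≤ []                 χ≈χ′ = χ≈χ′ (0ᵛ r) (ℕₚ.≤-reflexive (sum-0ᵛ r))
    pairing-cong-≤ {suc n} (c ∷ rs) χ≈χ′ = +-cong
      (linear-cong-units c (λ u ∣u∣≡1 → pairing-cong-≤ rs (λ s ∣s∣≤n →
        χ≈χ′ (u +ᵛ s) (∣u+s∣≤1+n u s ∣u∣≡1 ∣s∣≤n))))
      (pairing-cong-≤ rs (λ s ∣s∣≤n → χ≈χ′ s (ℕₚ.m≤n⇒m≤1+n ∣s∣≤n)))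
      where
      ∣u+s∣≤1+n : ∀ u s → sum u ≡ 1 → sum s ≤ n → sum (u +ᵛ s) ≤ suc n
      ∣u+s∣≤1+n u s ∣u∣≡1 ∣s∣≤n =
        ℕₚ.≤-trans (ℕₚ.≤-reflexive (≡.trans (sum-+ᵛ u s) (cong (Nat._+ sum s) ∣u∣≡1))) (s≤s ∣s∣≤n)

    pairing-0 : ∀ {n} (rs : Vec (Vec A r) n) → pairing rs (λ _ → 0#) ≈ 0#
    pairing-0 []       = ≈-refl
    pairing-0 (c ∷ rs) = ≈-trans
      (+-cong (≈-trans (weightedSum-cong (units r) c (λ _ → pairing-0 rs)) (weightedSum-0 (units r) c)) (pairing-0 rs))
      (+-identityˡ 0#)

    pairing-+ : ∀ {n} (rs : Vec (Vec A r) n) (χ χ′ : Vec ℕ r → A) →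
      pairing rs (λ s → χ s + χ′ s) ≈ pairing rs χ + pairing rs χ′
    pairing-+ []       χ χ′ = ≈-refl
    pairing-+ (c ∷ rs) χ χ′ = ≈-trans
      (+-cong (≈-trans (weightedSum-cong (units r) c (λ u → pairing-+ rs _ _)) (weightedSum-+ (units r) c _ _))
              (pairing-+ rs χ χ′))
      (+-interchange _ _ _ _)

    pairing-Σ : ∀ {B : Set} {n} (rs : Vec (Vec A r) n) (bs : List B) (χ : B → Vec ℕ r → A) →
      pairing rs (λ s → Σ bs (λ b → χ b s)) ≈ Σ bs (λ b → pairing rs (χ b))
    pairing-Σ rs []       χ = pairing-0 rs
    pairing-Σ rs (b ∷ bs) χ = ≈-trans (pairing-+ rs _ _) (+-congˡ (pairing-Σ rs bs χ))

    pairing-if0 : ∀ {n} (rs : Vec (Vec A r) n) b (χ : Vec ℕ r → A) →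
      if0 b (pairing rs χ) ≈ pairing rs (λ s → if0 b (χ s))
    pairing-if0 rs true  χ = ≈-refl
    pairing-if0 rs false χ = ≈-sym (pairing-0 rs)

  factor-coefficient : ∀ {r} (cs : Vec A r) (δ : Vec ℕ r) →
    factor cs δ ≈ linear cs (λ u → [ eqVᵇ δ u ]) + oneT δ
  factor-coefficient {r} cs δ = ≈-trans (monomials (V.allFin r) cs)
    (+-congʳ (≈-reflexive (cong (λ us → weightedSum us cs (λ u → [ eqVᵇ δ u ])) (map-unitV r))))
    where
    monomials : ∀ {p} (ls : Vec (Fin r) p) (xs : Vec A p) →
      V.foldr′ _⊞_ oneT (V.zipWith mono ls xs) δ ≈ weightedSum (V.map unitV ls) xs (λ u → [ eqVᵇ δ u ]) + oneT δ
    monomials []       []       = ≈-sym (+-identityˡ _)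
    monomials (l ∷ ls) (x ∷ xs) = ≈-trans (+-cong (≈-sym x[b]≈if0) (monomials ls xs)) (≈-sym (+-assoc _ _ _))
      where
      x[b]≈if0 : x * [ eqVᵇ δ (unitV l) ] ≈ if0 (eqVᵇ δ (unitV l)) x
      x[b]≈if0 = ≈-trans (*-comm x _) (indicator-* _ x)

  factor-∙ : ∀ {r} (cs : Vec A r) (Q : TP r) (δ : Vec ℕ r) →
    (factor cs ∙ Q) δ ≈ linear cs (λ u → if0 (u ≤ᵛᵇ δ) (Q (δ ∸ᵛ u))) + Q δ
  factor-∙ {r} cs Q δ = begin
    Σ (below δ) (λ δ′ → factor cs δ′ * Q (δ ∸ᵛ δ′))
      ≈⟨ Σ-cong (below δ) (λ δ′ → ≈-trans (*-congʳ (factor-coefficient cs δ′)) (distribʳ _ _ _)) ⟩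
    Σ (below δ) (λ δ′ → linear cs (λ u → [ eqVᵇ δ′ u ]) * Q (δ ∸ᵛ δ′) + oneT δ′ * Q (δ ∸ᵛ δ′))
      ≈⟨ Σ-+ (below δ) _ _ ⟩
    Σ (below δ) (λ δ′ → linear cs (λ u → [ eqVᵇ δ′ u ]) * Q (δ ∸ᵛ δ′))
      + Σ (below δ) (λ δ′ → oneT δ′ * Q (δ ∸ᵛ δ′))
      ≈⟨ +-cong (≈-trans (Σ-cong (below δ) (λ δ′ → weightedSum-*ʳ _ (units r) cs _))
                (≈-trans (Σ-weightedSum (below δ) (units r) cs _) (weightedSum-cong (units r) cs selectBelow)))
                (selectBelow (0ᵛ r)) ⟩
    linear cs (λ u → if0 (u ≤ᵛᵇ δ) (Q (δ ∸ᵛ u))) + if0 (0ᵛ r ≤ᵛᵇ δ) (Q (δ ∸ᵛ 0ᵛ r))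
      ≡⟨ cong (linear cs (λ u → if0 (u ≤ᵛᵇ δ) (Q (δ ∸ᵛ u))) +_)
           (≡.trans (cong (λ b → if0 b (Q (δ ∸ᵛ 0ᵛ r))) (0ᵛ-≤ᵛᵇ δ)) (cong Q (∸ᵛ-identityʳ δ))) ⟩
    linear cs (λ u → if0 (u ≤ᵛᵇ δ) (Q (δ ∸ᵛ u))) + Q δ ∎
    where
    selectBelow : ∀ u → Σ (below δ) (λ δ′ → [ eqVᵇ δ′ u ] * Q (δ ∸ᵛ δ′)) ≈ if0 (u ≤ᵛᵇ δ) (Q (δ ∸ᵛ u))
    selectBelow u =
      ≈-trans (Σ-cong (below δ) (λ δ′ → indicator-* _ _)) (Σ-below-eqVᵇ δ u (λ δ′ → Q (δ ∸ᵛ δ′)))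

  product : ∀ {r n} → Vec (Vec A r) n → TP r
  product rs = V.foldr′ _∙_ oneT (V.map factor rs)

  rowsOf : ∀ {n r} → Vec (Fin n → A) r → Vec (Vec A r) n
  rowsOf {n} fs = V.map (λ i → V.map (λ f → f i) fs) (V.allFin n)

  e≡product : ∀ n {r} (δ : Vec ℕ r) (fs : Vec (Fin n → A) r) → e n δ fs ≡ product (rowsOf fs) δ
  e≡product n δ fs =
    cong (λ ps → V.foldr′ _∙_ oneT ps δ) (V.map-∘ factor (λ i → V.map (λ f → f i) fs) (V.allFin n))

  product-coefficient : ∀ {r n} (rs : Vec (Vec A r) n) (δ : Vec ℕ r) →
    product rs δ ≈ pairing rs (λ s → [ eqVᵇ δ s ])
  product-coefficient []       δ = ≈-refl
  product-coefficient (c ∷ rs) δ = ≈-trans (factor-∙ c (product rs) δ)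
    (+-cong (weightedSum-cong (units _) c shifted) (product-coefficient rs δ))
    where
    shifted : ∀ u → if0 (u ≤ᵛᵇ δ) (product rs (δ ∸ᵛ u))
                  ≈ pairing rs (λ s → [ eqVᵇ δ (u +ᵛ s) ])
    shifted u = begin
      if0 (u ≤ᵛᵇ δ) (product rs (δ ∸ᵛ u))
        ≈⟨ if0-cong (u ≤ᵛᵇ δ) (product-coefficient rs (δ ∸ᵛ u)) ⟩
      if0 (u ≤ᵛᵇ δ) (pairing rs (λ s → [ eqVᵇ (δ ∸ᵛ u) s ]))
        ≈⟨ pairing-if0 rs (u ≤ᵛᵇ δ) _ ⟩
      pairing rs (λ s → if0 (u ≤ᵛᵇ δ) [ eqVᵇ (δ ∸ᵛ u) s ])
        ≈⟨ pairing-cong rs (λ s → ≈-reflexive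
             (≡.trans (≡.sym (if0-∧ (u ≤ᵛᵇ δ) _ 1#)) (cong [_] (≡.sym (eqVᵇ-+ᵛ δ u s))))) ⟩
      pairing rs (λ s → [ eqVᵇ δ (u +ᵛ s) ]) ∎

  -- combine-linear says (1 + Σ_l cF_l t_l)(1 + Σ_j cG_j u_j) = 1 + Σ_w (combine cF cG)_w t^(πF w) u^(πG w),
  -- tested against every Φ.
  module _ {k h p : ℕ} (πF : Vec ℕ p → Vec ℕ k) (πG : Vec ℕ p → Vec ℕ h)
           (πF-+ᵛ : ∀ s t → πF (s +ᵛ t) ≡ πF s +ᵛ πF t)
           (πG-+ᵛ : ∀ s t → πG (s +ᵛ t) ≡ πG s +ᵛ πG t)
           (πF-0ᵛ : πF (0ᵛ p) ≡ 0ᵛ k) (πG-0ᵛ : πG (0ᵛ p) ≡ 0ᵛ h)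
           (combine : Vec A k → Vec A h → Vec A p)
           (combine-linear : ∀ cF cG (Φ : Vec ℕ k → Vec ℕ h → A) →
              linear cF (λ u → Φ u (0ᵛ h)) + (linear cG (Φ (0ᵛ k)) + linear cF (λ u → linear cG (Φ u)))
                ≈ linear (combine cF cG) (λ w → Φ (πF w) (πG w))) where

    pairing-* : ∀ {n} (rsF : Vec (Vec A k) n) (rsG : Vec (Vec A h) n) (χF : Vec ℕ k → A) (χG : Vec ℕ h → A) →
      pairing rsF χF * pairing rsG χG ≈ pairing (V.zipWith combine rsF rsG) (λ s → χF (πF s) * χG (πG s))
    pairing-* []         []         χF χG =
      *-cong (≈-reflexive (cong χF (≡.sym πF-0ᵛ))) (≈-reflexive (cong χG (≡.sym πG-0ᵛ)))
    pairing-* (cF ∷ rsF) (cG ∷ rsG) χF χG = begin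
      (linear cF shiftedF + pairing rsF χF) * (linear cG shiftedG + pairing rsG χG)
        ≈⟨ expand _ _ _ _ ⟩
      (linear cF shiftedF * pairing rsG χG
        + (pairing rsF χF * linear cG shiftedG + linear cF shiftedF * linear cG shiftedG))
        + pairing rsF χF * pairing rsG χG
        ≈⟨ +-cong (+-cong fTerms (+-cong gTerms fgTerms)) (pairing-* rsF rsG χF χG) ⟩
      (linear cF (λ u → Φ u (0ᵛ h)) + (linear cG (Φ (0ᵛ k)) + linear cF (λ u → linear cG (Φ u)))) + pairing rsB χB
        ≈⟨ +-congʳ (≈-trans (combine-linear cF cG Φ) (weightedSum-cong (units p) (combine cF cG) shift)) ⟩
      linear (combine cF cG) (λ w → pairing rsB (λ s → χB (w +ᵛ s))) + pairing rsB χB ∎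
      where
      rsB : Vec (Vec A p) _
      rsB = V.zipWith combine rsF rsG
      χB : Vec ℕ p → A
      χB s = χF (πF s) * χG (πG s)
      shiftedF : Vec ℕ k → A
      shiftedF u = pairing rsF (λ s → χF (u +ᵛ s))
      shiftedG : Vec ℕ h → A
      shiftedG v = pairing rsG (λ s → χG (v +ᵛ s))
      Φ : Vec ℕ k → Vec ℕ h → A
      Φ u v = pairing rsB (λ s → χF (u +ᵛ πF s) * χG (v +ᵛ πG s))

      expand : ∀ a b c d → (a + b) * (c + d) ≈ (a * d + (b * c + a * c)) + b * d
      expand a b c d = ≈-trans (distribʳ _ a b) (≈-trans (+-cong (distribˡ a c d) (distribˡ b c d))
        (≈-trans (≈-sym (+-assoc _ _ _)) (+-congʳ (xy∙z≈y∙zx _ _ _))))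

      ih : ∀ u v → shiftedF u * shiftedG v ≈ Φ u v
      ih u v = pairing-* rsF rsG _ _
      unshiftF : pairing rsF χF ≈ shiftedF (0ᵛ k)
      unshiftF = pairing-cong rsF (λ s → ≈-reflexive (cong χF (≡.sym (+ᵛ-identityˡ s))))
      unshiftG : pairing rsG χG ≈ shiftedG (0ᵛ h)
      unshiftG = pairing-cong rsG (λ s → ≈-reflexive (cong χG (≡.sym (+ᵛ-identityˡ s))))

      fTerms : linear cF shiftedF * pairing rsG χG ≈ linear cF (λ u → Φ u (0ᵛ h))
      fTerms = ≈-trans (weightedSum-*ʳ _ (units k) cF shiftedF)
        (weightedSum-cong (units k) cF (λ u → ≈-trans (*-congˡ unshiftG) (ih u (0ᵛ h))))
      gTerms : pairing rsF χF * linear cG shiftedG ≈ linear cG (Φ (0ᵛ k))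
      gTerms = ≈-trans (weightedSum-*ˡ _ (units h) cG shiftedG)
        (weightedSum-cong (units h) cG (λ v → ≈-trans (*-congʳ unshiftF) (ih (0ᵛ k) v)))
      fgTerms : linear cF shiftedF * linear cG shiftedG ≈ linear cF (λ u → linear cG (Φ u))
      fgTerms = ≈-trans (weightedSum-* (units k) cF (units h) cG shiftedF shiftedG)
        (weightedSum-cong (units k) cF (λ u → weightedSum-cong (units h) cG (ih u)))
      shift : ∀ w → Φ (πF w) (πG w) ≈ pairing rsB (λ s → χB (w +ᵛ s))
      shift w = pairing-cong rsB (λ s →
        ≈-reflexive (≡.sym (cong₂ (λ a b → χF a * χG b) (πF-+ᵛ w s) (πG-+ᵛ w s))))

  combRow : ∀ {k h} → Vec A k → Vec A h → Vec A (dim k h)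
  combRow cF cG = cF ++ (cG ++ outer _*_ cF cG)

  outer-linear : ∀ {k h} (cF : Vec A k) (cG : Vec A h) (Ψ : Vec ℕ k → Vec ℕ h → A) →
    linear (outer _*_ cF cG) (λ e → Ψ (rowSums (matrix k h e)) (columnSums (matrix k h e)))
      ≈ linear cF (λ u → linear cG (Ψ u))
  outer-linear             []       cG Ψ = ≈-refl
  outer-linear {suc k} {h} (x ∷ cF) cG Ψ = begin
    linear (V.map (x *_) cG ++ outer _*_ cF cG) Ψ′
      ≈⟨ linear-++ (V.map (x *_) cG) (outer _*_ cF cG) Ψ′ ⟩
    linear (V.map (x *_) cG) (λ v → Ψ′ (v ++ 0ᵛ (k Nat.* h)))
      + linear (outer _*_ cF cG) (λ e → Ψ′ (0ᵛ h ++ e))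
      ≈⟨ +-cong (≈-trans (weightedSum-scale x (units h) cG _) (*-congˡ (linear-cong-units cG firstRow)))
                (≈-trans (weightedSum-cong (units (k Nat.* h)) (outer _*_ cF cG) (≈-reflexive ∘ otherRows))
                         (outer-linear cF cG (λ u → Ψ (0 ∷ u)))) ⟩
    x * linear cG (Ψ (1 ∷ 0ᵛ k)) + linear cF (λ u → linear cG (Ψ (0 ∷ u)))
      ≡⟨ linear-∷ x cF (λ u → linear cG (Ψ u)) ⟨
    linear (x ∷ cF) (λ u → linear cG (Ψ u)) ∎
    where
    Ψ′ : Vec ℕ (suc k Nat.* h) → A
    Ψ′ e = Ψ (rowSums (matrix (suc k) h e)) (columnSums (matrix (suc k) h e))
    firstRow : ∀ v → sum v ≡ 1 → Ψ′ (v ++ 0ᵛ (k Nat.* h)) ≈ Ψ (1 ∷ 0ᵛ k) v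
    firstRow v ∣v∣≡1 = ≈-reflexive (≡.trans (cong (λ M → Ψ (rowSums M) (columnSums M)) (matrix-++ k h v _))
      (cong₂ Ψ (cong₂ _∷_ ∣v∣≡1 (rowSums-matrix-0ᵛ k h))
               (≡.trans (cong (v +ᵛ_) (columnSums-matrix-0ᵛ k h)) (+ᵛ-identityʳ v))))
    otherRows : ∀ e → Ψ′ (0ᵛ h ++ e) ≡ Ψ (0 ∷ rowSums (matrix k h e)) (columnSums (matrix k h e))
    otherRows e = ≡.trans (cong (λ M → Ψ (rowSums M) (columnSums M)) (matrix-++ k h (0ᵛ h) e))
      (cong₂ Ψ (cong (_∷ rowSums (matrix k h e)) (sum-0ᵛ h)) (+ᵛ-identityˡ _))

  combRow-linear : ∀ {k h} (cF : Vec A k) (cG : Vec A h) (Φ : Vec ℕ k → Vec ℕ h → A) →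
    linear cF (λ u → Φ u (0ᵛ h)) + (linear cG (Φ (0ᵛ k)) + linear cF (λ u → linear cG (Φ u)))
      ≈ linear (combRow cF cG) (λ w → Φ (fMargin k h w) (gMargin k h w))
  combRow-linear {k} {h} cF cG Φ = ≈-sym (begin
    linear (cF ++ (cG ++ outer _*_ cF cG)) Φ′
      ≈⟨ linear-++ cF (cG ++ outer _*_ cF cG) Φ′ ⟩
    linear cF (λ u → Φ′ (u ++ 0ᵛ (h Nat.+ k Nat.* h))) + linear (cG ++ outer _*_ cF cG) (λ w → Φ′ (0ᵛ k ++ w))
      ≈⟨ +-congˡ (linear-++ cG (outer _*_ cF cG) _) ⟩
    linear cF (λ u → Φ′ (u ++ 0ᵛ (h Nat.+ k Nat.* h)))
      + (linear cG (λ v → Φ′ (0ᵛ k ++ (v ++ 0ᵛ (k Nat.* h))))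
         + linear (outer _*_ cF cG) (λ e → Φ′ (0ᵛ k ++ (0ᵛ h ++ e))))
      ≈⟨ +-cong (weightedSum-cong (units k) cF (≈-reflexive ∘ fPoint))
                (+-cong (weightedSum-cong (units h) cG (≈-reflexive ∘ gPoint))
                        (≈-trans (weightedSum-cong (units (k Nat.* h)) (outer _*_ cF cG) (≈-reflexive ∘ fgPoint))
                                 (outer-linear cF cG Φ))) ⟩
    linear cF (λ u → Φ u (0ᵛ h)) + (linear cG (Φ (0ᵛ k)) + linear cF (λ u → linear cG (Φ u))) ∎)
    where
    Φ′ : Vec ℕ (dim k h) → A
    Φ′ w = Φ (fMargin k h w) (gMargin k h w)
    gPoint : ∀ v → Φ′ (0ᵛ k ++ (v ++ 0ᵛ (k Nat.* h))) ≡ Φ (0ᵛ k) v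
    gPoint v = cong₂ Φ (fMargin-++-0ᵛ k h (0ᵛ k) v) (gMargin-++-0ᵛ k h (0ᵛ k) v)
    fPoint : ∀ u → Φ′ (u ++ 0ᵛ (h Nat.+ k Nat.* h)) ≡ Φ u (0ᵛ h)
    fPoint u = ≡.trans (cong (λ z → Φ′ (u ++ z)) (0ᵛ-++ h (k Nat.* h)))
      (cong₂ Φ (fMargin-++-0ᵛ k h u (0ᵛ h)) (gMargin-++-0ᵛ k h u (0ᵛ h)))
    fgPoint : ∀ e → Φ′ (0ᵛ k ++ (0ᵛ h ++ e)) ≡ Φ (rowSums (matrix k h e)) (columnSums (matrix k h e))
    fgPoint e = cong₂ Φ (≡.trans (fMargin-++ k h (0ᵛ k) (0ᵛ h) e) (+ᵛ-identityˡ _))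
                        (≡.trans (gMargin-++ k h (0ᵛ k) (0ᵛ h) e) (+ᵛ-identityˡ _))

  pairing-*-combRow : ∀ {k h n} (rsF : Vec (Vec A k) n) (rsG : Vec (Vec A h) n)
    (χF : Vec ℕ k → A) (χG : Vec ℕ h → A) →
    pairing rsF χF * pairing rsG χG
      ≈ pairing (V.zipWith combRow rsF rsG) (λ s → χF (fMargin k h s) * χG (gMargin k h s))
  pairing-*-combRow {k} {h} = pairing-* (fMargin k h) (gMargin k h) (fMargin-+ᵛ k h) (gMargin-+ᵛ k h)
    (fMargin-0ᵛ k h) (gMargin-0ᵛ k h) combRow combRow-linear

-- The index set of the theorem is defined in PolyRing R but does not depend on R.
module ProductFormula {c₀ ℓ₀} (R : CommutativeRing c₀ ℓ₀) {c ℓ} (CR : CommutativeRing c ℓ) where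
  open PolyRing R using (Γ; flat; admissible; candidates; indexSet)
  open CommutativeRing CR
    renaming (Carrier to A; refl to ≈-refl; sym to ≈-sym; trans to ≈-trans; reflexive to ≈-reflexive)
  open Sums CR
  open Expansion CR
  open import Relation.Binary.Reasoning.Setoid setoid

  module _ {n : ℕ} where

    candidates-selects : ∀ {k h} {a : Vec ℕ k} {b : Vec ℕ h} {M : Vec (Vec ℕ h) k} →
      All (_≤ n) a → All (_≤ n) b → All (All (_≤ n)) M →
      Selects (λ γ γ₀ → eqVᵇ (flat γ) (flat γ₀)) (candidates k h n) (a , b , M)
    candidates-selects {k} {h} {a} {b} {M} a≤n b≤n M≤n ψ = begin
      Σ (candidates k h n) (λ γ → if0 (eqVᵇ (flat γ) (flat (a , b , M))) (ψ γ))
        ≈⟨ Σ-concatMap _ rowsF _ ⟩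
      Σ rowsF (λ a′ → Σ (concatMap (λ b′ → L.map (λ M′ → a′ , b′ , M′) matrices) rowsG) φ)
        ≈⟨ Σ-cong rowsF (λ a′ → ≈-trans (Σ-concatMap _ rowsG _) (Σ-cong rowsG (λ b′ → Σ-map _ matrices _))) ⟩
      Σ rowsF (λ a′ → Σ rowsG (λ b′ → Σ matrices (λ M′ → φ (a′ , b′ , M′))))
        ≈⟨ Σ-cong rowsF (λ a′ → ≈-trans (Σ-cong rowsG (λ b′ → ≈-trans
             (Σ-cong matrices (λ M′ → ≈-reflexive (split a′ b′ M′))) (Σ-if0 (eqVᵇ a′ a) matrices _)))
             (Σ-if0 (eqVᵇ a′ a) rowsG _)) ⟩
      Σ rowsF (λ a′ → if0 (eqVᵇ a′ a) (Σ rowsG (λ b′ → Σ matrices (λ M′ →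
        if0 (eqVᵇ b′ b) (if0 (eqVᵇ (V.concat M′) (V.concat M)) (ψ (a′ , b′ , M′)))))))
        ≈⟨ Σ-cong rowsF (λ a′ → if0-cong (eqVᵇ a′ a) (Σ-cong rowsG (λ b′ →
             ≈-trans (Σ-if0 (eqVᵇ b′ b) matrices _) (if0-cong (eqVᵇ b′ b) (matrix-selects M≤n _))))) ⟩
      Σ rowsF (λ a′ → if0 (eqVᵇ a′ a) (Σ rowsG (λ b′ → if0 (eqVᵇ b′ b) (ψ (a′ , b′ , M)))))
        ≈⟨ Σ-cong rowsF (λ a′ → if0-cong (eqVᵇ a′ a) (row-selects b≤n _)) ⟩
      Σ rowsF (λ a′ → if0 (eqVᵇ a′ a) (ψ (a′ , b , M)))
        ≈⟨ row-selects a≤n _ ⟩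
      ψ (a , b , M) ∎
      where
      rowsF : List (Vec ℕ k)
      rowsF = allVec k (upTo (suc n))
      rowsG : List (Vec ℕ h)
      rowsG = allVec h (upTo (suc n))
      matrices : List (Vec (Vec ℕ h) k)
      matrices = allVec k (allVec h (upTo (suc n)))
      φ : Γ k h → A
      φ γ = if0 (eqVᵇ (flat γ) (flat (a , b , M))) (ψ γ)
      split : ∀ a′ b′ M′ → φ (a′ , b′ , M′)
        ≡ if0 (eqVᵇ a′ a) (if0 (eqVᵇ b′ b) (if0 (eqVᵇ (V.concat M′) (V.concat M)) (ψ (a′ , b′ , M′))))
      split a′ b′ M′ = ≡.trans
        (cong (λ t → if0 t (ψ (a′ , b′ , M′)))
          (≡.trans (eqVᵇ-++ a′ a _ _) (cong (eqVᵇ a′ a ∧_) (eqVᵇ-++ b′ b _ _))))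
        (≡.trans (if0-∧ (eqVᵇ a′ a) _ _) (cong (if0 (eqVᵇ a′ a)) (if0-∧ (eqVᵇ b′ b) _ _)))

  indexSet-count : ∀ {k h n} (α : Vec ℕ k) (β : Vec ℕ h) (s : Vec ℕ (dim k h)) → sum s ≤ n →
    Σ (indexSet k h n α β) (λ γ → [ eqVᵇ (flat γ) s ])
      ≈ [ eqVᵇ (fMargin k h s) α ] * [ eqVᵇ (gMargin k h s) β ]
  indexSet-count {k} {h} {n} α β s ∣s∣≤n = begin
    Σ (indexSet k h n α β) (λ γ → [ eqVᵇ (flat γ) s ])
      ≈⟨ Σ-filter (admissible n α β) (candidates k h n) _ ⟩
    Σ (candidates k h n) (λ γ → if0 (admissible n α β γ) [ eqVᵇ (flat γ) s ])
      ≈⟨ Σ-cong (candidates k h n) (λ γ → ≈-reflexive (≡.trans (if0-indicator-comm (admissible n α β γ) _)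
           (cong (λ t → if0 (eqVᵇ (flat γ) t) [ admissible n α β γ ]) (≡.sym (blocks-++ k h s))))) ⟩
    Σ (candidates k h n) (λ γ → if0 (eqVᵇ (flat γ) (flat γ₀)) [ admissible n α β γ ])
      ≈⟨ candidates-selects γF≤n γG≤n γFG≤n _ ⟩
    [ admissible n α β γ₀ ]
      ≡⟨ ≡.trans (if0-∧ (sum (flat γ₀) ≤ᵇ n) _ 1#) (if0-T _ (ℕₚ.≤⇒≤ᵇ ∣γ₀∣≤n)) ⟩
    [ eqVᵇ (fMargin k h s) α ∧ eqVᵇ (gMargin k h s) β ]
      ≈⟨ indicator-∧ _ _ ⟩
    [ eqVᵇ (fMargin k h s) α ] * [ eqVᵇ (gMargin k h s) β ] ∎
    where
    γ₀ : Γ k h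
    γ₀ = fBlock k h s , gBlock k h s , fgBlock k h s
    ∣γ₀∣≤n : sum (flat γ₀) ≤ n
    ∣γ₀∣≤n = ≡.subst (λ t → sum t ≤ n) (≡.sym (blocks-++ k h s)) ∣s∣≤n
    γ≤n : All (_≤ n) (flat γ₀)
    γ≤n = sum-≤⇒all-≤ (flat γ₀) ∣γ₀∣≤n
    γF≤n : All (_≤ n) (fBlock k h s)
    γF≤n = proj₁ (Allₚ.++⁻ (fBlock k h s) γ≤n)
    γG,γFG≤n : All (_≤ n) (gBlock k h s ++ V.concat (fgBlock k h s))
    γG,γFG≤n = proj₂ (Allₚ.++⁻ (fBlock k h s) γ≤n)
    γG≤n : All (_≤ n) (gBlock k h s)
    γG≤n = proj₁ (Allₚ.++⁻ (gBlock k h s) γG,γFG≤n)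
    γFG≤n : All (All (_≤ n)) (fgBlock k h s)
    γFG≤n = Allₚ.concat⁻ (fgBlock k h s) (proj₂ (Allₚ.++⁻ (gBlock k h s) γG,γFG≤n))


  product-* : ∀ {k h n} (rsF : Vec (Vec A k) n) (rsG : Vec (Vec A h) n) (α : Vec ℕ k) (β : Vec ℕ h) →
    product rsF α * product rsG β ≈ Σ (indexSet k h n α β) (λ γ → product (V.zipWith combRow rsF rsG) (flat γ))
  product-* {k} {h} {n} rsF rsG α β = begin
    product rsF α * product rsG β
      ≈⟨ *-cong (product-coefficient rsF α) (product-coefficient rsG β) ⟩
    pairing rsF (λ s → [ eqVᵇ α s ]) * pairing rsG (λ s → [ eqVᵇ β s ])
      ≈⟨ pairing-*-combRow rsF rsG _ _ ⟩
    pairing rsB (λ s → [ eqVᵇ α (fMargin k h s) ] * [ eqVᵇ β (gMargin k h s) ])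
      ≈⟨ pairing-cong-≤ rsB (λ s ∣s∣≤n → ≈-trans
           (≈-reflexive (cong₂ (λ x y → [ x ] * [ y ]) (eqVᵇ-comm α (fMargin k h s)) (eqVᵇ-comm β (gMargin k h s))))
           (≈-sym (indexSet-count α β s ∣s∣≤n))) ⟩
    pairing rsB (λ s → Σ (indexSet k h n α β) (λ γ → [ eqVᵇ (flat γ) s ]))
      ≈⟨ pairing-Σ rsB (indexSet k h n α β) _ ⟩
    Σ (indexSet k h n α β) (λ γ → pairing rsB (λ s → [ eqVᵇ (flat γ) s ]))
      ≈⟨ Σ-cong (indexSet k h n α β) (λ γ → ≈-sym (product-coefficient rsB (flat γ))) ⟩
    Σ (indexSet k h n α β) (λ γ → product rsB (flat γ)) ∎
    where
    rsB : Vec (Vec A (dim k h)) n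
    rsB = V.zipWith combRow rsF rsG

module _ {c ℓ} (R : CommutativeRing c ℓ) {n m : ℕ} where
  open PolyRing R
  open Expansion (Pol-commutativeRing R (Fin m × Fin n)) using (rowsOf; combRow)

  rowsOf-products : ∀ {k h} (f : Vec (A₁ m) k) (g : Vec (A₁ m) h) →
    rowsOf (V.map at (f ++ (g ++ products f g))) ≡ V.zipWith combRow (rowsOf (V.map at f)) (rowsOf (V.map at g))
  rowsOf-products f g = trans (V.map-cong row (V.allFin n)) (sym (zipWith-map combRow _ _ (V.allFin n)))
    where
    row : ∀ i → V.map (λ φ → φ i) (V.map at (f ++ (g ++ products f g)))
              ≡ combRow (V.map (λ φ → φ i) (V.map at f)) (V.map (λ φ → φ i) (V.map at g))
    row i = begin
      V.map (λ φ → φ i) (V.map at (f ++ (g ++ products f g)))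
        ≡⟨ V.map-∘ (λ φ → φ i) at _ ⟨
      V.map (λ p → at p i) (f ++ (g ++ products f g))
        ≡⟨ V.map-++ (λ p → at p i) f _ ⟩
      V.map (λ p → at p i) f ++ V.map (λ p → at p i) (g ++ products f g)
        ≡⟨ cong (V.map (λ p → at p i) f ++_) (trans (V.map-++ (λ p → at p i) g _)
             (cong (V.map (λ p → at p i) g ++_) (map-outer (λ p → at p i) (λ _ _ → refl) f g))) ⟩
      combRow (V.map (λ p → at p i) f) (V.map (λ p → at p i) g)
        ≡⟨ cong₂ combRow (V.map-∘ (λ φ → φ i) at f) (V.map-∘ (λ φ → φ i) at g) ⟩
      combRow (V.map (λ φ → φ i) (V.map at f)) (V.map (λ φ → φ i) (V.map at g)) ∎
      where open ≡-Reasoning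

theorem2p1 : ∀ {c ℓ : Level} (R : CommutativeRing c ℓ) →
    let open PolyRing R in
    (n m : ℕ) → 1 ≤ n → 1 ≤ m →
    (k h : ℕ) (f : Vec (A₁ m) k) (g : Vec (A₁ m) h)
    (α : Vec ℕ k) (β : Vec ℕ h) → sum α ≤ n → sum β ≤ n →
    eδ n m α f ⊗ eδ n m β g
      ≋ sumA n m (map (λ γ → eδ n m (flat γ) (f ++ (g ++ products f g))) (indexSet k h n α β))
theorem2p1 {c} {ℓ} R n m _ _ k h f g α β _ _ = begin
  eδ n m α f ⊗ eδ n m β g
    ≡⟨ cong₂ _⊗_ (e≡product n α (V.map at f)) (e≡product n β (V.map at g)) ⟩
  product (rowsOf (V.map at f)) α ⊗ product (rowsOf (V.map at g)) β
    ≈⟨ product-* (rowsOf (V.map at f)) (rowsOf (V.map at g)) α β ⟩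
  Σ (indexSet k h n α β) (λ γ → product (V.zipWith combRow (rowsOf (V.map at f)) (rowsOf (V.map at g))) (flat γ))
    ≡⟨ cong (λ rs → Σ (indexSet k h n α β) (λ γ → product rs (flat γ))) (sym (rowsOf-products R f g)) ⟩
  Σ (indexSet k h n α β) (λ γ → product (rowsOf (V.map at fgfg)) (flat γ))
    ≈⟨ Σ-cong (indexSet k h n α β) (λ γ → reflexive (sym (e≡product n (flat γ) (V.map at fgfg)))) ⟩
  sumA n m (map (λ γ → eδ n m (flat γ) (f ++ (g ++ products f g))) (indexSet k h n α β)) ∎
  where
  open PolyRing R
  fgfg : Vec (A₁ m) (dim k h)
  fgfg = f ++ (g ++ products f g)
  CR : CommutativeRing c (c ⊔ ℓ)
  CR = Pol-commutativeRing R (Fin m × Fin n)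
  open CommutativeRing CR using (setoid; reflexive)
  open Sums CR using (Σ; Σ-cong)
  open Expansion CR using (product; rowsOf; e≡product; combRow)
  open ProductFormula R CR using (product-*)
  open import Relation.Binary.Reasoning.Setoid setoid
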